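{- Let $\Gamma=(S,E)$ be a graph, let $s\neq t$ be vertices of $\Gamma$, and let $G(C_\Gamma)$ be as in the context. Then the subgroups $S_5(s)$ and $S_5(t)$ are not conjugate in $G(C_\Gamma)$.
   Context: A Coxeter graph is a reflexive undirected graph on a set $X$ whose edges $\{x,y\}$ carry labels $m(x,y)=m(y,x)\in\mathbb N\setminus\{0\}$, with $m(x,y)=1$ iff $x=y$. Its Coxeter group is $\langle X \mid (xy)^{m(x,y)}=e \text{ for all adjacent } x,y\rangle$ (non-adjacent pairs get no relation). Given a graph $\Gamma=(S,E)$ (symmetric relation; loops, if any, are irrelevant), the Coxeter graph $C_\Gamma$ has vertices $s_1,s_2,s_3,s_4$ for each $s\in S$ and the following labelled edges (besides loops): $m(s_i,s_j)=3$ if $|i-j|=1$ and $m(s_i,s_j)=2$ if $|i-j|>1$; for distinct $s,t\in S$, an edge labelled $2$ between $s_4$ and $t_4$; for distinct $s,t\in S$ adjacent in $\Gamma$, edges labelled $2$ between $s_1$ and $t_1$, $s_1$ and $t_3$, $s_3$ and $t_3$, $s_3$ and $t_1$. No other edges. $G(C_\Gamma)$ is its Coxeter group, and $S_5(s)$ denotes the subgroup $\langle s_1,\dots,s_4\rangle$ of $G(C_\Gamma)$ (isomorphic to $S_5$). -}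

module Defs where

open import Data.Nat using (ℕ; zero; suc)
open import Data.Fin using (Fin; zero; suc)
open import Data.List using (List; []; _∷_; _++_; concat; replicate; reverse)
open import Data.List.Relation.Unary.All using (All)
open import Data.Product using (Σ; _×_; _,_; proj₁; ∃)
open import Relation.Binary.PropositionalEquality using (_≡_; _≢_)

-- A Coxeter graph on X: Lab x y m means "x and y are adjacent with label m".
CoxeterGraph : Set → Set₁
CoxeterGraph X = X → X → ℕ → Set

alt : {X : Set} → X → X → ℕ → List X
alt x y m = concat (replicate m (x ∷ y ∷ []))

-- The Coxeter group ⟨X | (xy)^m(x,y) = e for adjacent x,y⟩, elements
-- represented by words in X (every generator is an involution since
-- m(x,x)=1, so no formal inverse letters are needed); CoxEq C is the
-- congruence generated by the defining relations (CoxEq C u v : u = v in G(C)).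
data CoxEq {X : Set} (C : CoxeterGraph X) : List X → List X → Set where
  ≈-refl  : ∀ {u} → CoxEq C u u
  ≈-sym   : ∀ {u v} → CoxEq C u v → CoxEq C v u
  ≈-trans : ∀ {u v w} → CoxEq C u v → CoxEq C v w → CoxEq C u w
  ≈-cong  : ∀ {u v} (a b : List X) → CoxEq C u v → CoxEq C (a ++ u ++ b) (a ++ v ++ b)
  ≈-rel   : ∀ {x y m} → C x y m → CoxEq C (alt x y m) []

inv : {X : Set} → List X → List X
inv = reverse

-- The Coxeter graph C_Γ, vertices s_1..s_4 encoded as (s , i), i : Fin 4
-- (i = 0,1,2,3 stands for s_1,s_2,s_3,s_4).

data CΓ {S : Set} (E : S → S → Set) : CoxeterGraph (S × Fin 4) where
  loop  : ∀ s i → CΓ E (s , i) (s , i) 1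
  a12 : ∀ s → CΓ E (s , zero) (s , suc zero) 3
  a21 : ∀ s → CΓ E (s , suc zero) (s , zero) 3
  a23 : ∀ s → CΓ E (s , suc zero) (s , suc (suc zero)) 3
  a32 : ∀ s → CΓ E (s , suc (suc zero)) (s , suc zero) 3
  a34 : ∀ s → CΓ E (s , suc (suc zero)) (s , suc (suc (suc zero))) 3
  a43 : ∀ s → CΓ E (s , suc (suc (suc zero))) (s , suc (suc zero)) 3
  a13 : ∀ s → CΓ E (s , zero) (s , suc (suc zero)) 2
  a31 : ∀ s → CΓ E (s , suc (suc zero)) (s , zero) 2
  a14 : ∀ s → CΓ E (s , zero) (s , suc (suc (suc zero))) 2
  a41 : ∀ s → CΓ E (s , suc (suc (suc zero))) (s , zero) 2
  a24 : ∀ s → CΓ E (s , suc zero) (s , suc (suc (suc zero))) 2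
  a42 : ∀ s → CΓ E (s , suc (suc (suc zero))) (s , suc zero) 2
  b44 : ∀ s t → s ≢ t → CΓ E (s , suc (suc (suc zero))) (t , suc (suc (suc zero))) 2
  -- for distinct adjacent s, t: s_1–t_1, s_1–t_3, s_3–t_3, s_3–t_1
  -- (both orientations arise since E is symmetric)
  e11 : ∀ s t → s ≢ t → E s t → CΓ E (s , zero) (t , zero) 2
  e13 : ∀ s t → s ≢ t → E s t → CΓ E (s , zero) (t , suc (suc zero)) 2
  e31 : ∀ s t → s ≢ t → E s t → CΓ E (s , suc (suc zero)) (t , zero) 2
  e33 : ∀ s t → s ≢ t → E s t → CΓ E (s , suc (suc zero)) (t , suc (suc zero)) 2

InS5 : {S : Set} (E : S → S → Set) → S → List (S × Fin 4) → Set
InS5 E s w = Σ (List _) λ v → All (λ x → proj₁ x ≡ s) v × CoxEq (CΓ E) w v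

ConjugateSubgroups : {S : Set} (E : S → S → Set) →
  (List (S × Fin 4) → Set) → (List (S × Fin 4) → Set) → Set
ConjugateSubgroups E H K =
  Σ (List _) λ g →
    (∀ h → H h → K (g ++ h ++ inv g)) ×
    (∀ k → K k → H (inv g ++ k ++ g))

{-# OPTIONS --safe #-}
module Submission where

-- Send s_i to the transposition (i, i+1) of {1,…,5} and every generator of S5(u), u ≢ s,
-- to the identity. All edges of C_Γ between different blocks join s_i to t_j with
-- |i - j| ≠ 1, whose images commute, so this defines a homomorphism G(C_Γ) → S_5.
-- It kills S5(t) but no conjugate of s_1, so no conjugate of S5(s) lies in S5(t).

open import Defs
open import Relation.Binary.PropositionalEquality using (_≡_; _≢_)
open import Relation.Nullary using (¬_)
open import Relation.Binary.PropositionalEquality using (refl; sym; trans; cong; cong₂; _≗_; module ≡-Reasoning)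
open import Relation.Nullary.Decidable
  using (Dec; yes; no; does; does-≡; from-yes; decidable-stable; ¬¬-excluded-middle; ¬?; _→-dec_; _×-dec_; map′)
open import Relation.Nullary.Negation using (¬¬-Monad)
open import Data.Nat using (ℕ; zero; suc)
open import Data.Nat.Properties using () renaming (_≟_ to _≟ℕ_)
open import Data.Fin using (Fin; zero; suc; inject₁; _≟_)
open import Data.Fin.Properties using (all?)
open import Data.Fin.Permutation.Components using (transpose)
open import Data.Bool using (Bool; true; false; if_then_else_)
open import Data.List using (List; []; _∷_; _++_; [_])
open import Data.List.Properties using (++-assoc; unfold-reverse)
open import Data.List.Relation.Unary.All using (All; []; _∷_; universal; sequenceM)
open import Data.List.Relation.Unary.All.Properties using (++⁺; ++⁻ˡ; ++⁻ʳ)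
open import Data.Product using (_×_; _,_; proj₁)
open import Data.Sum using (_⊎_; inj₁; inj₂)
open import Data.Empty using (⊥-elim)
open import Function using (id; _∘_)
open import Function.Endo.Propositional (Fin 5) using (_^_)

inv-++-cancel : {X : Set} {C : CoxeterGraph X} → (∀ x → C x x 1) →
  ∀ g → CoxEq C (inv g ++ g) []
inv-++-cancel loops [] = ≈-refl
inv-++-cancel loops (x ∷ g) rewrite unfold-reverse x g | ++-assoc (inv g) [ x ] (x ∷ g) =
  ≈-trans (≈-cong (inv g) g (≈-rel (loops x))) (inv-++-cancel loops g)

conjugate-of-id : {A : Set} {f f⁻¹ h : A → A} →
  f⁻¹ ∘ f ≗ id → f ∘ h ∘ f⁻¹ ≗ id → h ≗ id
conjugate-of-id {f = f} {f⁻¹} {h} left-inv conj k = begin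
  h k                      ≡⟨ sym (left-inv (h k)) ⟩
  f⁻¹ (f (h k))            ≡⟨ cong (f⁻¹ ∘ f ∘ h) (sym (left-inv k)) ⟩
  f⁻¹ (f (h (f⁻¹ (f k))))  ≡⟨ cong f⁻¹ (conj (f k)) ⟩
  f⁻¹ (f k)                ≡⟨ left-inv k ⟩
  k                        ∎
  where open ≡-Reasoning

A₄ : Fin 4 → Fin 4 → ℕ
A₄ zero                   zero                   = 1
A₄ (suc zero)             (suc zero)             = 1
A₄ (suc (suc zero))       (suc (suc zero))       = 1
A₄ (suc (suc (suc zero))) (suc (suc (suc zero))) = 1
A₄ zero                   (suc zero)             = 3
A₄ (suc zero)             zero                   = 3
A₄ (suc zero)             (suc (suc zero))       = 3
A₄ (suc (suc zero))       (suc zero)             = 3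
A₄ (suc (suc zero))       (suc (suc (suc zero))) = 3
A₄ (suc (suc (suc zero))) (suc (suc zero))       = 3
A₄ _                      _                      = 2

σ : Fin 4 → Fin 5 → Fin 5
σ i = transpose (inject₁ i) (suc i)

σ-if : Bool → Fin 4 → Fin 5 → Fin 5
σ-if b i = if b then σ i else id

all-Bool? : {P : Bool → Set} → (∀ b → Dec (P b)) → Dec (∀ b → P b)
all-Bool? P? = map′ (λ (t , f) → λ { true → t ; false → f }) (λ h → h true , h false)
  (P? true ×-dec P? false)

σ-if-braid : ∀ b i j → (σ-if b i ∘ σ-if b j) ^ A₄ i j ≗ id
σ-if-braid = from-yes (all-Bool? λ b → all? λ i → all? λ j → all? λ k →
  ((σ-if b i ∘ σ-if b j) ^ A₄ i j) k ≟ k)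

σ-if-commute : ∀ b b′ i j → A₄ i j ≢ 3 → (σ-if b i ∘ σ-if b′ j) ^ 2 ≗ id
σ-if-commute = from-yes (all-Bool? λ b → all-Bool? λ b′ → all? λ i → all? λ j →
  ¬? (A₄ i j ≟ℕ 3) →-dec all? λ k → ((σ-if b i ∘ σ-if b′ j) ^ 2) k ≟ k)

module _ {S : Set} {E : S → S → Set} where

  CΓ-edge : ∀ {u i v j m} → CΓ E (u , i) (v , j) m →
    (u ≡ v × m ≡ A₄ i j) ⊎ (m ≡ 2 × A₄ i j ≢ 3)
  CΓ-edge (loop _ zero)                   = inj₁ (refl , refl)
  CΓ-edge (loop _ (suc zero))             = inj₁ (refl , refl)
  CΓ-edge (loop _ (suc (suc zero)))       = inj₁ (refl , refl)
  CΓ-edge (loop _ (suc (suc (suc zero)))) = inj₁ (refl , refl)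
  CΓ-edge (a12 _)                         = inj₁ (refl , refl)
  CΓ-edge (a21 _)                         = inj₁ (refl , refl)
  CΓ-edge (a23 _)                         = inj₁ (refl , refl)
  CΓ-edge (a32 _)                         = inj₁ (refl , refl)
  CΓ-edge (a34 _)                         = inj₁ (refl , refl)
  CΓ-edge (a43 _)                         = inj₁ (refl , refl)
  CΓ-edge (a13 _)                         = inj₁ (refl , refl)
  CΓ-edge (a31 _)                         = inj₁ (refl , refl)
  CΓ-edge (a14 _)                         = inj₁ (refl , refl)
  CΓ-edge (a41 _)                         = inj₁ (refl , refl)
  CΓ-edge (a24 _)                         = inj₁ (refl , refl)
  CΓ-edge (a42 _)                         = inj₁ (refl , refl)
  CΓ-edge (b44 _ _ _)                     = inj₂ (refl , λ ())
  CΓ-edge (e11 _ _ _ _)                   = inj₂ (refl , λ ())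
  CΓ-edge (e13 _ _ _ _)                   = inj₂ (refl , λ ())
  CΓ-edge (e31 _ _ _ _)                   = inj₂ (refl , λ ())
  CΓ-edge (e33 _ _ _ _)                   = inj₂ (refl , λ ())

-- Equality with s is not decidable, so each letter of a word carries a decision of
-- whether it belongs to S5(s). The image ⟦ w ⟧ does not depend on these decisions, and
-- decisions for any given word exist up to ¬¬, which suffices for equations in Fin 5.
module Projection {S : Set} (E : S → S → Set) (s : S) where

  Letter : Set
  Letter = S × Fin 4

  Tag : Letter → Set
  Tag (u , _) = Dec (u ≡ s)

  Tagging : List Letter → Set
  Tagging = All Tag

  tagging : ∀ w → ¬ ¬ Tagging w
  tagging = sequenceM _ ¬¬-Monad ∘ universal (λ _ → ¬¬-excluded-middle)

  ⟦_⟧ : ∀ w → Tagging w → Fin 5 → Fin 5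
  ⟦ [] ⟧          []       = id
  ⟦ (_ , i) ∷ w ⟧ (d ∷ ds) = σ-if (does d) i ∘ ⟦ w ⟧ ds

  ⟦⟧-irrelevant : ∀ w (d d′ : Tagging w) → ⟦ w ⟧ d ≗ ⟦ w ⟧ d′
  ⟦⟧-irrelevant []            []       []         k = refl
  ⟦⟧-irrelevant ((_ , i) ∷ w) (d ∷ ds) (d′ ∷ ds′) k =
    cong₂ (λ b → σ-if b i) (does-≡ d d′) (⟦⟧-irrelevant w ds ds′ k)

  ⟦⟧-++ : ∀ a {u} (d : Tagging (a ++ u)) (da : Tagging a) (du : Tagging u) →
    ⟦ a ++ u ⟧ d ≗ ⟦ a ⟧ da ∘ ⟦ u ⟧ du
  ⟦⟧-++ []            d        []        du   = ⟦⟧-irrelevant _ d du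
  ⟦⟧-++ ((_ , i) ∷ a) (d ∷ ds) (d′ ∷ da) du k =
    cong₂ (λ b → σ-if b i) (does-≡ d d′) (⟦⟧-++ a ds da du k)

  ⟦⟧-++³ : ∀ a u b (d : Tagging (a ++ u ++ b)) (da : Tagging a) (du : Tagging u) (db : Tagging b) →
    ⟦ a ++ u ++ b ⟧ d ≗ ⟦ a ⟧ da ∘ ⟦ u ⟧ du ∘ ⟦ b ⟧ db
  ⟦⟧-++³ a u b d da du db k =
    trans (⟦⟧-++ a d da (++⁺ du db) k) (cong (⟦ a ⟧ da) (⟦⟧-++ u (++⁺ du db) du db k))

  ⟦⟧-alt : ∀ {u i v j} m (d : Tagging (alt (u , i) (v , j) m)) (du : Dec (u ≡ s)) (dv : Dec (v ≡ s)) →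
    ⟦ alt (u , i) (v , j) m ⟧ d ≗ (σ-if (does du) i ∘ σ-if (does dv) j) ^ m
  ⟦⟧-alt zero    []              du dv k = refl
  ⟦⟧-alt (suc m) (du′ ∷ dv′ ∷ d) du dv k
    rewrite does-≡ du′ du | does-≡ dv′ dv | ⟦⟧-alt m d du dv k = refl

  σ-if-relator : ∀ {u i v j m} → CΓ E (u , i) (v , j) m → (du : Dec (u ≡ s)) (dv : Dec (v ≡ s)) →
    (σ-if (does du) i ∘ σ-if (does dv) j) ^ m ≗ id
  σ-if-relator {i = i} {j = j} r du dv with CΓ-edge r
  ... | inj₁ (refl , refl) rewrite does-≡ dv du = σ-if-braid (does du) i j
  ... | inj₂ (refl , ≢3)   = σ-if-commute (does du) (does dv) i j ≢3

  ⟦⟧-relator : ∀ {x y m} → CΓ E x y m → (d : Tagging (alt x y m)) → ⟦ alt x y m ⟧ d ≗ id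
  ⟦⟧-relator {m = zero}  r []              k = refl
  ⟦⟧-relator {m = suc m} r d@(du ∷ dv ∷ _) k =
    trans (⟦⟧-alt (suc m) d du dv k) (σ-if-relator r du dv k)

  ⟦⟧-resp-≈ : ∀ {w v} → CoxEq (CΓ E) w v → (dw : Tagging w) (dv : Tagging v) → ⟦ w ⟧ dw ≗ ⟦ v ⟧ dv
  ⟦⟧-resp-≈ ≈-refl dw dv = ⟦⟧-irrelevant _ dw dv
  ⟦⟧-resp-≈ (≈-sym e) dw dv k = sym (⟦⟧-resp-≈ e dv dw k)
  ⟦⟧-resp-≈ (≈-trans {v = m} e e′) dw dv k =
    decidable-stable (_ ≟ _) λ ≢ → tagging m λ dm →
      ≢ (trans (⟦⟧-resp-≈ e dw dm k) (⟦⟧-resp-≈ e′ dm dv k))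
  ⟦⟧-resp-≈ (≈-cong {u} {v} a b e) dw dw′ k = begin
    ⟦ a ++ u ++ b ⟧ dw k              ≡⟨ ⟦⟧-++³ a u b dw da du db k ⟩
    ⟦ a ⟧ da (⟦ u ⟧ du (⟦ b ⟧ db k))  ≡⟨ cong (⟦ a ⟧ da) (⟦⟧-resp-≈ e du dv (⟦ b ⟧ db k)) ⟩
    ⟦ a ⟧ da (⟦ v ⟧ dv (⟦ b ⟧ db k))  ≡⟨ sym (⟦⟧-++³ a v b dw′ da dv db k) ⟩
    ⟦ a ++ v ++ b ⟧ dw′ k             ∎
    where
    open ≡-Reasoning
    da = ++⁻ˡ a dw
    du = ++⁻ˡ u (++⁻ʳ a dw)
    db = ++⁻ʳ u (++⁻ʳ a dw)
    dv = ++⁻ˡ v (++⁻ʳ a dw′)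
  ⟦⟧-resp-≈ (≈-rel r) dw [] = ⟦⟧-relator r dw

  ⟦inv⟧-∘-⟦⟧ : ∀ g (dg⁻¹ : Tagging (inv g)) (dg : Tagging g) → ⟦ inv g ⟧ dg⁻¹ ∘ ⟦ g ⟧ dg ≗ id
  ⟦inv⟧-∘-⟦⟧ g dg⁻¹ dg k =
    trans (sym (⟦⟧-++ (inv g) d dg⁻¹ dg k)) (⟦⟧-resp-≈ (inv-++-cancel (λ (u , i) → loop u i) g) d [] k)
    where d = ++⁺ dg⁻¹ dg

  ⟦⟧-other-vertex : ∀ {t w} → t ≢ s → All (λ x → proj₁ x ≡ t) w → (d : Tagging w) → ⟦ w ⟧ d ≗ id
  ⟦⟧-other-vertex t≢s []          []             k = refl
  ⟦⟧-other-vertex t≢s (refl ∷ ps) (yes t≡s ∷ d) k = ⊥-elim (t≢s t≡s)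
  ⟦⟧-other-vertex t≢s (refl ∷ ps) (no _ ∷ d)    k = ⟦⟧-other-vertex t≢s ps d k

σ₀≢id : ¬ (σ zero ≗ id)
σ₀≢id σ₀≗id with σ₀≗id zero
... | ()

lemma4p15 : (S : Set) (E : S → S → Set) → (∀ {a b} → E a b → E b a) →
    (s t : S) → s ≢ t →
    ¬ ConjugateSubgroups E (InS5 E s) (InS5 E t)
lemma4p15 S E _ s t s≢t (g , conj , _)
  with conj [ (s , zero) ] ([ (s , zero) ] , refl ∷ [] , ≈-refl)
... | v , v∈S5t , conj≈v =
  tagging g λ dg → tagging (inv g) λ dg⁻¹ → tagging v λ dv →
  let d = ++⁺ dg (++⁺ (yes refl ∷ []) dg⁻¹) in
  σ₀≢id (conjugate-of-id {f = ⟦ g ⟧ dg} {⟦ inv g ⟧ dg⁻¹} (⟦inv⟧-∘-⟦⟧ g dg⁻¹ dg) λ k → begin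
    ⟦ g ⟧ dg (σ zero (⟦ inv g ⟧ dg⁻¹ k))  ≡⟨ sym (⟦⟧-++³ g _ (inv g) d dg (yes refl ∷ []) dg⁻¹ k) ⟩
    ⟦ g ++ [ (s , zero) ] ++ inv g ⟧ d k  ≡⟨ ⟦⟧-resp-≈ conj≈v d dv k ⟩
    ⟦ v ⟧ dv k                            ≡⟨ ⟦⟧-other-vertex (s≢t ∘ sym) v∈S5t dv k ⟩
    k                                     ∎)
  where
  open Projection E s
  open ≡-Reasoning
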